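{- Let $G$ be a finite non-bipartite graph, let $m\ge 2$ be an integer and let $r,s$ be non-negative integers with $1\leq \frac{2r+1}{2s+1}<og(G)$. Then $G^{\frac{2r+1}{2s+1}}\longrightarrow K_m$ if and only if $G\longrightarrow H(m,1,r+1)^{2s+1}$.
   Context: $G\longrightarrow H$ means there is a homomorphism (adjacency-preserving vertex map) from $G$ to $H$. $og(G)$ is the odd girth of $G$. For a positive integer $k$, $G^{k}$ has vertex set $V(G)$, with $u,v$ adjacent iff there is a walk of length $k$ between them. $S_t(G)$ replaces each edge of $G$ by a path with exactly $t-1$ inner vertices, and $G^{\frac{2r+1}{2s+1}}:=(S_{2s+1}(G))^{2r+1}$. $K_m$ is the complete graph. For positive integers $m,n,k$ with $m\ge 2n$, the helical graph $H(m,n,k)$ has as vertices all $k$-tuples $(A_1,\ldots,A_k)$ of subsets of $[m]=\{1,\ldots,m\}$ with $|A_1|=n$, $|A_i|\ge n$ for all $i$, $A_i\cap A_{i+1}=\emptyset$ for $i\le k-1$, and $A_t\subseteq A_{t+2}$ for $t\le k-2$; two vertices $(A_1,\ldots,A_k)$ and $(B_1,\ldots,B_k)$ are adjacent iff $A_i\cap B_i=\emptyset$ for all $1\le i\le k$ and $A_j\subseteq B_{j+1}$, $B_j\subseteq A_{j+1}$ for all $1\le j\le k-1$. -}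

module Defs where

open import Level using (0ℓ)
open import Data.Nat using (ℕ; zero; suc; _+_; _*_; _∸_; _≤_; _<_)
open import Data.Nat.Base using (_<ᵇ_)
open import Data.Bool using (Bool; true; false; T; _∧_)
open import Data.Fin using (Fin; toℕ)
open import Data.Fin.Subset using (Subset; _⊆_; _∩_; ∣_∣; Empty)
open import Data.Product using (Σ; ∃; _×_; _,_)
open import Data.Sum using (_⊎_; inj₁; inj₂)
open import Relation.Binary.PropositionalEquality using (_≡_; _≢_)
open import Relation.Nullary using (¬_)

record Graph : Set₁ where
  field
    V : Set
    E : V → V → Set
open Graph public

record FinGraph : Set where
  field
    n    : ℕ
    adj  : Fin n → Fin n → Bool
    sym  : ∀ u v → adj u v ≡ adj v u
    irr  : ∀ u → adj u u ≡ false
open FinGraph public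

toGraph : FinGraph → Graph
toGraph G = record { V = Fin (n G) ; E = λ u v → T (adj G u v) }

_⟶_ : Graph → Graph → Set
G ⟶ H = Σ (V G → V H) λ f → ∀ {u v} → E G u v → E H (f u) (f v)

K : ℕ → Graph
K m = record { V = Fin m ; E = λ u v → u ≢ v }

data Walk (G : Graph) : ℕ → V G → V G → Set where
  here : ∀ {u} → Walk G zero u u
  step : ∀ {k u w v} → E G u w → Walk G k w v → Walk G (suc k) u v

power : ℕ → Graph → Graph
power k G = record { V = V G ; E = Walk G k }

-- Subdivision S_t(G): each edge {u,v} (stored once, oriented u < v) is
-- replaced by the path u = x_0, x_1, ..., x_{t-1}, x_t = v, where the
-- inner vertex x_j (1 ≤ j ≤ t-1) is (u , v , j-1).
InnerV : FinGraph → ℕ → Set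
InnerV G t = Σ (Fin (n G) × Fin (n G) × Fin (t ∸ 1))
               λ { (u , v , _) → T (adj G u v ∧ (toℕ u <ᵇ toℕ v)) }

SubE : (G : FinGraph) (t : ℕ) → (Fin (n G) ⊎ InnerV G t) → (Fin (n G) ⊎ InnerV G t) → Set
SubE G t (inj₁ u) (inj₁ v) = (t ≡ 1) × T (adj G u v)
SubE G t (inj₁ w) (inj₂ ((u , v , i) , _)) =
  ((w ≡ u) × (toℕ i ≡ 0)) ⊎ ((w ≡ v) × (suc (toℕ i) ≡ t ∸ 1))
SubE G t (inj₂ ((u , v , i) , _)) (inj₁ w) =
  ((w ≡ u) × (toℕ i ≡ 0)) ⊎ ((w ≡ v) × (suc (toℕ i) ≡ t ∸ 1))
SubE G t (inj₂ ((u , v , i) , _)) (inj₂ ((u' , v' , i') , _)) =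
  (u ≡ u') × (v ≡ v') × ((suc (toℕ i) ≡ toℕ i') ⊎ (suc (toℕ i') ≡ toℕ i))

S : ℕ → FinGraph → Graph
S t G = record { V = Fin (n G) ⊎ InnerV G t ; E = SubE G t }

fracPow : FinGraph → ℕ → ℕ → Graph
fracPow G r s = power (suc (2 * r)) (S (suc (2 * s)) G)

Odd : ℕ → Set
Odd ℓ = ∃ λ q → ℓ ≡ suc (2 * q)

Cycle : Graph → ℕ → Set
Cycle G ℓ = (3 ≤ ℓ) × Σ (Fin ℓ → V G) λ c →
    (∀ i j → c i ≡ c j → i ≡ j)
  × (∀ i j → (suc (toℕ i) ≡ toℕ j) ⊎ ((suc (toℕ i) ≡ ℓ) × (toℕ j ≡ 0))
           → E G (c i) (c j))

IsOddGirth : Graph → ℕ → Set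
IsOddGirth G g = (Odd g × Cycle G g) × (∀ ℓ → Odd ℓ → Cycle G ℓ → g ≤ ℓ)

Bipartite : Graph → Set
Bipartite G = G ⟶ K 2

-- Helical graph H(m,n,k); tuples (A_1,…,A_k) are indexed by Fin k
-- (A_1 is index 0).
HV : ℕ → ℕ → ℕ → Set
HV m n k = Σ (Fin k → Subset m) λ A →
    (∀ i → toℕ i ≡ 0 → ∣ A i ∣ ≡ n)
  × (∀ i → n ≤ ∣ A i ∣)
  × (∀ i j → suc (toℕ i) ≡ toℕ j → Empty (A i ∩ A j))
  × (∀ i j → 2 + toℕ i ≡ toℕ j → A i ⊆ A j)

HE : (m n k : ℕ) → HV m n k → HV m n k → Set
HE m n k (A , _) (B , _) =
    (∀ i → Empty (A i ∩ B i))
  × (∀ i j → suc (toℕ i) ≡ toℕ j → (A i ⊆ B j) × (B i ⊆ A j))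

Helical : ℕ → ℕ → ℕ → Graph
Helical m n k = record { V = HV m n k ; E = HE m n k }

-- Given an m-colouring of S_t(G)^{2r+1}, send a vertex v of S_t(G) to the tuple
-- (A_0,…,A_r), where A_i is the set of colours seen at the ends of walks of length i
-- from v. A walk of length a to one end and of length a+1 to another combine into an
-- odd walk of length at most 2r+1, whose ends the colouring separates; this gives the
-- disjointness conditions of H(m,1,r+1), and prolonging walks gives the inclusions.
-- Conversely, a walk of length 2r+1 in H(m,1,r+1) pushes the singletons A_0 of both
-- ends into the two disjoint sets A_r of its middle edge, so "the element of A_0"
-- colours H(m,1,r+1)^{2r+1}. Finally a homomorphism S_t(G) → H amounts to a
-- homomorphism G → H^t, reading each subdivided edge as a walk of length t.
module Submission where

open import Defs hiding (sym)
open import Data.Nat using (ℕ; suc; _*_; _≤_; _<_)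
open import Data.Product using (_×_)
open import Relation.Nullary using (¬_)

open import Data.Nat using (zero; _+_; _<ᵇ_; z≤n; s≤s; _≤′_; ≤′-reflexive; ≤′-step)
  renaming (_≟_ to _≟ℕ_; _<?_ to _<?ℕ_)
open import Data.Nat.Properties
  using (+-suc; +-identityʳ; *-suc; ≤⇒≤′; ≤-pred; <⇒<ᵇ; ≮⇒≥; n≤0⇒n≡0; <-irrefl; ≤-antisym; m≤m+n; ≤-refl; ≤-<-trans; m<n⇒m<1+n)
open import Data.Bool using (T; _∧_)
open import Data.Bool.Properties using (T-∧; T-≡; T-irrelevant)
open import Data.Empty using (⊥-elim)
open import Data.Fin using (Fin; toℕ; fromℕ; fromℕ<) renaming (_≟_ to _≟F_)
open import Data.Fin.Properties using (toℕ<n; toℕ-fromℕ; toℕ-fromℕ<; toℕ-injective; <-cmp; any?)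
open import Data.Fin.Subset using (Subset; _⊆_; _∩_; ∣_∣; Empty; Nonempty; ⁅_⁆; _∈_)
open import Data.Fin.Subset.Properties
  using (nonempty?; Empty-unique; ∣⊥∣≡0; ∣⁅x⁆∣≡1; x∈⁅x⁆; x∈⁅y⁆⇒x≡y; p⊆q⇒∣p∣≤∣q∣; ⊆-antisym; x∈p∩q⁺; x∈p∩q⁻)
open import Data.Vec using (tabulate)
open import Data.Vec.Properties using (lookup∘tabulate; lookup⇒[]=; []=⇒lookup)
open import Data.Product using (Σ; _,_; proj₁; proj₂)
open import Data.Sum using (_⊎_; inj₁; inj₂; swap)
open import Function using (_∘_)
open import Function.Bundles using (Equivalence)
open import Relation.Binary.Definitions using (Symmetric; Decidable; tri<; tri≈; tri>)
open import Relation.Binary.PropositionalEquality using (_≡_; refl; sym; trans; cong; subst; _≢_)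
open import Relation.Nullary using (Dec; yes; no)
open import Relation.Nullary.Decidable using (_×-dec_; _⊎-dec_; T?; isYes; toWitness; fromWitness)
import Relation.Unary as U

Searchable : Set → Set₁
Searchable A = ∀ (P : A → Set) → U.Decidable P → Dec (Σ A P)

∣p∣≡1⇒Nonempty : ∀ {m} (p : Subset m) → ∣ p ∣ ≡ 1 → Nonempty p
∣p∣≡1⇒Nonempty {m} p ∣p∣≡1 with nonempty? p
... | yes ne = ne
... | no empty with trans (sym (∣⊥∣≡0 m)) (trans (cong ∣_∣ (sym (Empty-unique empty))) ∣p∣≡1)
...   | ()

x∈p⇒1≤∣p∣ : ∀ {m x} {p : Subset m} → x ∈ p → 1 ≤ ∣ p ∣
x∈p⇒1≤∣p∣ {x = x} x∈p =
  subst (_≤ _) (∣⁅x⁆∣≡1 x) (p⊆q⇒∣p∣≤∣q∣ λ y∈⁅x⁆ → subst (_∈ _) (sym (x∈⁅y⁆⇒x≡y x y∈⁅x⁆)) x∈p)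

module _ {G : Graph} where

  castʷ : ∀ {k l u v} → k ≡ l → Walk G k u v → Walk G l u v
  castʷ refl W = W

  _++ʷ_ : ∀ {a b u w v} → Walk G a u w → Walk G b w v → Walk G (a + b) u v
  here     ++ʷ W′ = W′
  step e W ++ʷ W′ = step e (W ++ʷ W′)

  snocʷ : ∀ {k u v w} → Walk G k u v → E G v w → Walk G (suc k) u w
  snocʷ here        e = step e here
  snocʷ (step e′ W) e = step e′ (snocʷ W e)

  reverseʷ : Symmetric (E G) → ∀ {k u v} → Walk G k u v → Walk G k v u
  reverseʷ E-sym here       = here
  reverseʷ E-sym (step e W) = snocʷ (reverseʷ E-sym W) (E-sym e)

  splitAtʷ : ∀ a {b u v} → Walk G (a + b) u v → Σ (V G) λ w → Walk G a u w × Walk G b w v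
  splitAtʷ zero    W          = _ , here , W
  splitAtʷ (suc a) (step e W) with splitAtʷ a W
  ... | w , W₁ , W₂ = w , step e W₁ , W₂

  walk-one : ∀ {k u v} → k ≡ 1 → Walk G k u v → E G u v
  walk-one refl (step e here) = e

  -- Going back and forth along the first edge adds 2 to the length.
  lengthen-odd : Symmetric (E G) → ∀ {a b u v} → a ≤′ b → Walk G (suc (2 * a)) u v → Walk G (suc (2 * b)) u v
  lengthen-odd E-sym (≤′-reflexive refl) W = W
  lengthen-odd E-sym {b = suc b} (≤′-step a≤′b) W with lengthen-odd E-sym a≤′b W
  ... | step e W′ = castʷ (cong suc (sym (*-suc 2 b))) (step e (step (E-sym e) (step e W′)))

  vertexAt : ∀ {k u v} → Walk G k u v → ℕ → V G
  vertexAt {u = u} here       _       = u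
  vertexAt {u = u} (step _ _) zero    = u
  vertexAt         (step _ W) (suc i) = vertexAt W i

  vertexAt-zero : ∀ {k u v} (W : Walk G k u v) → vertexAt W 0 ≡ u
  vertexAt-zero here       = refl
  vertexAt-zero (step _ _) = refl

  vertexAt-end : ∀ {k u v} (W : Walk G k u v) → vertexAt W k ≡ v
  vertexAt-end here       = refl
  vertexAt-end (step _ W) = vertexAt-end W

  vertexAt-edge : ∀ {k u v} (W : Walk G k u v) i → i < k → E G (vertexAt W i) (vertexAt W (suc i))
  vertexAt-edge (step {u = u} e W) zero    _         = subst (E G u) (sym (vertexAt-zero W)) e
  vertexAt-edge (step e W)         (suc i) (s≤s i<k) = vertexAt-edge W i i<k

  walk-of-sequence : (q : ℕ → V G) → ∀ L → (∀ j → j < L → E G (q j) (q (suc j))) → Walk G L (q 0) (q L)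
  walk-of-sequence q zero    edges = here
  walk-of-sequence q (suc L) edges =
    step (edges 0 (s≤s z≤n)) (walk-of-sequence (λ j → q (suc j)) L λ j j<L → edges (suc j) (s≤s j<L))

_∘ʰ_ : ∀ {A B C : Graph} → B ⟶ C → A ⟶ B → A ⟶ C
g ∘ʰ f = (λ x → proj₁ g (proj₁ f x)) , λ e → proj₂ g (proj₂ f e)

mapʷ : ∀ {G H : Graph} (f : G ⟶ H) {k u v} → Walk G k u v → Walk H k (proj₁ f u) (proj₁ f v)
mapʷ f here       = here
mapʷ f (step e W) = step (proj₂ f e) (mapʷ f W)

power-map : ∀ {G H : Graph} k → G ⟶ H → power k G ⟶ power k H
power-map k f = proj₁ f , mapʷ f

module _ (G : FinGraph) (N : ℕ) where

  private
    X = S (suc N) G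

  S-sym : Symmetric (SubE G (suc N))
  S-sym {inj₁ u} {inj₁ v} (N≡0 , a) = N≡0 , subst T (FinGraph.sym G u v) a
  S-sym {inj₁ _} {inj₂ _} e = e
  S-sym {inj₂ _} {inj₁ _} e = e
  S-sym {inj₂ _} {inj₂ _} (u≡u′ , v≡v′ , next) = sym u≡u′ , sym v≡v′ , swap next

  S-edge? : Decidable (SubE G (suc N))
  S-edge? (inj₁ u) (inj₁ v) = (suc N ≟ℕ 1) ×-dec T? (adj G u v)
  S-edge? (inj₁ w) (inj₂ ((u , v , i) , _)) =
    ((w ≟F u) ×-dec (toℕ i ≟ℕ 0)) ⊎-dec ((w ≟F v) ×-dec (suc (toℕ i) ≟ℕ N))
  S-edge? (inj₂ ((u , v , i) , _)) (inj₁ w) =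
    ((w ≟F u) ×-dec (toℕ i ≟ℕ 0)) ⊎-dec ((w ≟F v) ×-dec (suc (toℕ i) ≟ℕ N))
  S-edge? (inj₂ ((u , v , i) , _)) (inj₂ ((u′ , v′ , i′) , _)) =
    (u ≟F u′) ×-dec (v ≟F v′) ×-dec ((suc (toℕ i) ≟ℕ toℕ i′) ⊎-dec (suc (toℕ i′) ≟ℕ toℕ i))

  S-searchable : Searchable (V X)
  S-searchable P P? with any? (λ u → P? (inj₁ u)) | any? (λ u → any? (λ v → any? (λ i → inner? u v i)))
    where
    inner? : ∀ u v i → Dec (Σ (T (adj G u v ∧ (toℕ u <ᵇ toℕ v))) λ p → P (inj₂ ((u , v , i) , p)))
    inner? u v i with T? (adj G u v ∧ (toℕ u <ᵇ toℕ v))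
    ... | no ¬p = no λ (p , _) → ¬p p
    ... | yes p with P? (inj₂ ((u , v , i) , p))
    ...   | yes Pp = yes (p , Pp)
    ...   | no ¬Pp = no λ (p′ , Pp′) → ¬Pp (subst (λ q → P (inj₂ ((u , v , i) , q))) (T-irrelevant p′ p) Pp′)
  ... | yes (u , Pu) | _ = yes (inj₁ u , Pu)
  ... | no _ | yes (u , v , i , p , Pp) = yes (inj₂ ((u , v , i) , p) , Pp)
  ... | no ¬outer | no ¬inner = no λ { (inj₁ u , Pu) → ¬outer (u , Pu)
                                     ; (inj₂ ((u , v , i) , p) , Pp) → ¬inner (u , v , i , p , Pp) }

  -- The path u, (u,v,0), …, (u,v,N-1), v; for N = 0 it is the single edge uv.
  oriented-edge-walk : ∀ {u v} → T (adj G u v ∧ (toℕ u <ᵇ toℕ v)) → Walk X (suc N) (inj₁ u) (inj₁ v)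
  oriented-edge-walk {u} {v} p = subst (Walk X (suc N) (inj₁ u)) (after-end (N <?ℕ N)) walk
    where
    after : ∀ j → Dec (j < N) → V X
    after j (yes j<N) = inj₂ ((u , v , fromℕ< j<N) , p)
    after j (no _)    = inj₁ v

    after-end : (d : Dec (N < N)) → after N d ≡ inj₁ v
    after-end (yes N<N) = ⊥-elim (<-irrefl refl N<N)
    after-end (no _)    = refl

    first-edge : (d : Dec (0 < N)) → SubE G (suc N) (inj₁ u) (after 0 d)
    first-edge (yes 0<N) = inj₁ (refl , toℕ-fromℕ< 0<N)
    first-edge (no 0≮N)  = cong suc (n≤0⇒n≡0 (≮⇒≥ 0≮N)) , Equivalence.to T-∧ p .proj₁

    next-edge : ∀ j → j < N → (d : Dec (j < N)) (d′ : Dec (suc j < N)) → SubE G (suc N) (after j d) (after (suc j) d′)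
    next-edge j j<N (no j≮N)   _ = ⊥-elim (j≮N j<N)
    next-edge j j<N (yes j<N′) (yes 1+j<N) =
      refl , refl , inj₁ (trans (cong suc (toℕ-fromℕ< j<N′)) (sym (toℕ-fromℕ< 1+j<N)))
    next-edge j j<N (yes j<N′) (no 1+j≮N) =
      inj₂ (refl , trans (cong suc (toℕ-fromℕ< j<N′)) (≤-antisym j<N (≮⇒≥ 1+j≮N)))

    vertex : ℕ → V X
    vertex zero    = inj₁ u
    vertex (suc j) = after j (j <?ℕ N)

    edges : ∀ j → j < suc N → SubE G (suc N) (vertex j) (vertex (suc j))
    edges zero    _         = first-edge (0 <?ℕ N)
    edges (suc j) (s≤s j<N) = next-edge j j<N (j <?ℕ N) (suc j <?ℕ N)

    walk : Walk X (suc N) (inj₁ u) (vertex (suc N))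
    walk = walk-of-sequence vertex (suc N) edges

  edge-walk : ∀ {u v} → T (adj G u v) → Walk X (suc N) (inj₁ u) (inj₁ v)
  edge-walk {u} {v} a with <-cmp u v
  ... | tri< u<v _ _ = oriented-edge-walk (Equivalence.from T-∧ (a , <⇒<ᵇ u<v))
  ... | tri≈ _ refl _ = ⊥-elim (subst T (irr G u) a)
  ... | tri> _ _ v<u =
    reverseʷ S-sym (oriented-edge-walk (Equivalence.from T-∧ (subst T (FinGraph.sym G u v) a , <⇒<ᵇ v<u)))

  subdivision⇒power : ∀ {H : Graph} → S (suc N) G ⟶ H → toGraph G ⟶ power (suc N) H
  subdivision⇒power h = (λ u → proj₁ h (inj₁ u)) , λ a → mapʷ h (edge-walk a)

module _ {H : Graph} (E-sym : Symmetric (E H)) (G : FinGraph) (N : ℕ)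
         (f : toGraph G ⟶ power (suc N) H) where

  private
    image : ∀ {u v} → T (adj G u v ∧ (toℕ u <ᵇ toℕ v)) → Walk H (suc N) (proj₁ f u) (proj₁ f v)
    image p = proj₂ f (Equivalence.to T-∧ p .proj₁)

    vertex : V (S (suc N) G) → V H
    vertex (inj₁ u)                 = proj₁ f u
    vertex (inj₂ ((u , v , i) , p)) = vertexAt (image p) (suc (toℕ i))

    inner-edge : ∀ {x y} (W : Walk H (suc N) x y) (i i′ : Fin N) → suc (toℕ i) ≡ toℕ i′ →
                 E H (vertexAt W (suc (toℕ i))) (vertexAt W (suc (toℕ i′)))
    inner-edge W i i′ i→i′ rewrite i→i′ = vertexAt-edge W (toℕ i′) (m<n⇒m<1+n (toℕ<n i′))

    end-edge : ∀ {w u v i} (p : T (adj G u v ∧ (toℕ u <ᵇ toℕ v))) →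
               ((w ≡ u) × (toℕ i ≡ 0)) ⊎ ((w ≡ v) × (suc (toℕ i) ≡ N)) →
               E H (proj₁ f w) (vertex (inj₂ ((u , v , i) , p)))
    end-edge p (inj₁ (refl , i≡0)) rewrite i≡0 =
      subst (λ x → E H x (vertexAt (image p) 1)) (vertexAt-zero (image p)) (vertexAt-edge (image p) 0 (s≤s z≤n))
    end-edge p (inj₂ (refl , 1+i≡N)) rewrite 1+i≡N =
      E-sym (subst (E H _) (vertexAt-end (image p)) (vertexAt-edge (image p) N ≤-refl))

    edge : ∀ {x y} → SubE G (suc N) x y → E H (vertex x) (vertex y)
    edge {inj₁ u} {inj₁ v} (1+N≡1 , a)           = walk-one 1+N≡1 (proj₂ f a)
    edge {inj₁ w} {inj₂ ((u , v , i) , p)} e      = end-edge p e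
    edge {inj₂ ((u , v , i) , p)} {inj₁ w} e      = E-sym (end-edge p e)
    edge {inj₂ ((u , v , i) , p)} {inj₂ ((_ , _ , i′) , p′)} (refl , refl , next)
      rewrite T-irrelevant p′ p with next
    ... | inj₁ i→i′ = inner-edge (image p) i i′ i→i′
    ... | inj₂ i′→i = E-sym (inner-edge (image p) i′ i i′→i)

  power⇒subdivision : S (suc N) G ⟶ H
  power⇒subdivision = vertex , edge

helical-sym : ∀ m n k → Symmetric (E (Helical m n k))
helical-sym m n k (disjoint , shifted) =
  (λ i (x , x∈B∩A) → let (x∈B , x∈A) = x∈p∩q⁻ _ _ x∈B∩A in disjoint i (x , x∈p∩q⁺ (x∈A , x∈B))) ,
  (λ i j i→j → let (A⊆B , B⊆A) = shifted i j i→j in B⊆A , A⊆B)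

helical-walk-⊆ : ∀ {m n k} {X Z : HV m n k} j → Walk (Helical m n k) j X Z →
                 ∀ (a b : Fin k) → toℕ b ≡ toℕ a + j → proj₁ X a ⊆ proj₁ Z b
helical-walk-⊆ {X = X} zero here a b b≡a+0 =
  subst (λ b′ → proj₁ X a ⊆ proj₁ X b′) (toℕ-injective (sym (trans b≡a+0 (+-identityʳ _)))) λ x∈ → x∈
helical-walk-⊆ (suc j) (step (_ , shifted) W) a b b≡a+1+j x∈ =
  helical-walk-⊆ j W a′ b (trans b≡a+1+j (trans (+-suc (toℕ a) j) (cong (_+ j) (sym (toℕ-fromℕ< a<k)))))
    (proj₁ (shifted a a′ (sym (toℕ-fromℕ< a<k))) x∈)
  where
  a<k : suc (toℕ a) < _
  a<k = ≤-<-trans (subst (suc (toℕ a) ≤_) (sym (trans b≡a+1+j (+-suc (toℕ a) j))) (m≤m+n _ j)) (toℕ<n b)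
  a′ = fromℕ< a<k

helical-power-colouring : ∀ m r → power (suc (2 * r)) (Helical m 1 (suc r)) ⟶ K m
helical-power-colouring m r = colour , colour-≢
  where
  colour-∈ : (X : HV m 1 (suc r)) → Nonempty (proj₁ X Fin.zero)
  colour-∈ (A , ∣A₀∣≡1 , _) = ∣p∣≡1⇒Nonempty (A Fin.zero) (∣A₀∣≡1 Fin.zero refl)

  colour : HV m 1 (suc r) → Fin m
  colour X = proj₁ (colour-∈ X)

  0→r : toℕ (fromℕ r) ≡ toℕ {suc r} Fin.zero + r
  0→r = toℕ-fromℕ r

  2r+1≡r+1+r : suc (2 * r) ≡ r + suc r
  2r+1≡r+1+r = trans (cong (λ x → suc (r + x)) (+-identityʳ r)) (sym (+-suc r r))

  colour-≢ : ∀ {X Y} → Walk (Helical m 1 (suc r)) (suc (2 * r)) X Y → colour X ≢ colour Y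
  colour-≢ {X} {Y} W with splitAtʷ r (castʷ 2r+1≡r+1+r W)
  ... | Z , W₁ , step (disjoint , _) W₂ = λ cX≡cY →
    disjoint (fromℕ r)
      ( colour X
      , x∈p∩q⁺ ( helical-walk-⊆ r W₁ Fin.zero (fromℕ r) 0→r (proj₂ (colour-∈ X))
               , helical-walk-⊆ r (reverseʷ (λ {P} {Q} → helical-sym m 1 (suc r) {P} {Q}) W₂) Fin.zero (fromℕ r) 0→r
                   (subst (_∈ _) (sym cX≡cY) (proj₂ (colour-∈ Y)))))

alternating : ∀ {m′ k} → HV (suc (suc m′)) 1 k
alternating {m′} =
  (λ i → ⁅ parity (toℕ i) ⁆) ,
  (λ i _ → ∣⁅x⁆∣≡1 (parity (toℕ i))) ,
  (λ i → x∈p⇒1≤∣p∣ (x∈⁅x⁆ (parity (toℕ i)))) ,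
  (λ i j i→j (x , x∈∩) → let (x∈i , x∈j) = x∈p∩q⁻ _ _ x∈∩ in
     parity-≢ (toℕ i) (trans (sym (x∈⁅y⁆⇒x≡y _ x∈i)) (trans (x∈⁅y⁆⇒x≡y _ x∈j) (cong parity (sym i→j))))) ,
  (λ i j i→j x∈ → subst (λ l → _ ∈ ⁅ parity l ⁆) i→j x∈)
  where
  parity : ℕ → Fin (suc (suc m′))
  parity zero          = Fin.zero
  parity (suc zero)    = Fin.suc Fin.zero
  parity (suc (suc k)) = parity k

  parity-≢ : ∀ k → parity k ≢ parity (suc k)
  parity-≢ zero          ()
  parity-≢ (suc zero)    ()
  parity-≢ (suc (suc k)) = parity-≢ k

module _ {X : Graph} (E-sym : Symmetric (E X)) (E? : Decidable (E X)) (search : Searchable (V X))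
         {m′ r : ℕ} (c : power (suc (2 * r)) X ⟶ K (suc (suc m′))) where

  private
    m = suc (suc m′)

    colour : V X → Fin m
    colour = proj₁ c

    ReachesColour : ℕ → V X → Fin m → Set
    ReachesColour k v x = Σ (V X) λ w → Walk X k v w × colour w ≡ x

    reaches? : ∀ k v x → Dec (ReachesColour k v x)
    reaches? zero v x with colour v ≟F x
    ... | yes cv≡x = yes (v , here , cv≡x)
    ... | no cv≢x  = no λ { (_ , here , cv≡x) → cv≢x cv≡x }
    reaches? (suc k) v x with search (λ u → E X v u × ReachesColour k u x) (λ u → E? v u ×-dec reaches? k u x)
    ... | yes (u , e , w , W , cw≡x) = yes (w , step e W , cw≡x)
    ... | no ¬reach = no λ { (w , step e W , cw≡x) → ¬reach (_ , e , w , W , cw≡x) }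

    reachable : V X → ℕ → Subset m
    reachable v k = tabulate λ x → isYes (reaches? k v x)

    ∈-reachable⁺ : ∀ {k v x} → ReachesColour k v x → x ∈ reachable v k
    ∈-reachable⁺ {k} {v} {x} reach =
      lookup⇒[]= x _ (trans (lookup∘tabulate (λ y → isYes (reaches? k v y)) x) (Equivalence.to T-≡ (fromWitness reach)))

    ∈-reachable⁻ : ∀ {k v x} → x ∈ reachable v k → ReachesColour k v x
    ∈-reachable⁻ {k} {v} {x} x∈ =
      toWitness (Equivalence.from T-≡ (trans (sym (lookup∘tabulate (λ y → isYes (reaches? k v y)) x)) ([]=⇒lookup x∈)))

    reachable-zero : ∀ v → reachable v 0 ≡ ⁅ colour v ⁆
    reachable-zero v = ⊆-antisym (λ x∈ → zero-reach (∈-reachable⁻ x∈))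
                                 (λ x∈ → ∈-reachable⁺ (v , here , sym (x∈⁅y⁆⇒x≡y _ x∈)))
      where
      zero-reach : ∀ {x} → ReachesColour 0 v x → x ∈ ⁅ colour v ⁆
      zero-reach (_ , here , cv≡x) = subst (_∈ _) cv≡x (x∈⁅x⁆ (colour v))

    reachable-⊆ : ∀ {a b v u} → (∀ {w} → Walk X a v w → Walk X b u w) → reachable v a ⊆ reachable u b
    reachable-⊆ extend x∈ = let (w , W , cw≡x) = ∈-reachable⁻ x∈ in ∈-reachable⁺ (w , extend W , cw≡x)

    consecutive-lengths-colour-≢ : ∀ {a v w₁ w₂} → a ≤ r → Walk X a v w₁ → Walk X (suc a) v w₂ → colour w₁ ≢ colour w₂
    consecutive-lengths-colour-≢ {a} a≤r W₁ W₂ =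
      proj₂ c (lengthen-odd E-sym (≤⇒≤′ a≤r) (castʷ a+1+a≡2a+1 (reverseʷ E-sym W₁ ++ʷ W₂)))
      where
      a+1+a≡2a+1 : a + suc a ≡ suc (2 * a)
      a+1+a≡2a+1 = trans (+-suc a a) (cong (λ x → suc (a + x)) (sym (+-identityʳ a)))

    reachable-disjoint : ∀ {a b v u} → a ≤ r → (∀ {w} → Walk X b u w → Walk X (suc a) v w) →
                         Empty (reachable v a ∩ reachable u b)
    reachable-disjoint a≤r extend (x , x∈∩) =
      let (x∈A , x∈B)    = x∈p∩q⁻ _ _ x∈∩
          (_ , W₁ , c₁≡x) = ∈-reachable⁻ x∈A
          (_ , W₂ , c₂≡x) = ∈-reachable⁻ x∈B
      in consecutive-lengths-colour-≢ a≤r W₁ (extend W₂) (trans c₁≡x (sym c₂≡x))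

    index≤r : (i : Fin (suc r)) → toℕ i ≤ r
    index≤r i = ≤-pred (toℕ<n i)

    -- The neighbour is needed only so that every A_i is nonempty.
    helical-vertex : ∀ v → Σ (V X) (E X v) → HV m 1 (suc r)
    helical-vertex v (u , e) =
      (λ i → reachable v (toℕ i)) ,
      (λ i i≡0 → trans (cong (λ k → ∣ reachable v k ∣) i≡0) (trans (cong ∣_∣ (reachable-zero v)) (∣⁅x⁆∣≡1 (colour v)))) ,
      (λ i → let (w , W) = walk-of-length (toℕ i) in x∈p⇒1≤∣p∣ (∈-reachable⁺ (w , W , refl))) ,
      (λ i j i→j → reachable-disjoint (index≤r i) (castʷ (sym i→j))) ,
      (λ i j i→j → reachable-⊆ λ W → castʷ i→j (step e (step (E-sym e) W)))
      where
      walk-of-length : ∀ k → Σ (V X) (Walk X k v)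
      walk-of-length zero          = v , here
      walk-of-length (suc zero)    = u , step e here
      walk-of-length (suc (suc k)) = let (w , W) = walk-of-length k in w , step e (step (E-sym e) W)

    vertex : ∀ v → Dec (Σ (V X) (E X v)) → HV m 1 (suc r)
    vertex v (yes neighbour) = helical-vertex v neighbour
    vertex v (no _)          = alternating

    edge : ∀ {v u} → E X v u → ∀ d d′ → HE m 1 (suc r) (vertex v d) (vertex u d′)
    edge e (no ¬nv) _ = ⊥-elim (¬nv (_ , e))
    edge e (yes _) (no ¬nu) = ⊥-elim (¬nu (_ , E-sym e))
    edge e (yes _) (yes _) =
      (λ i → reachable-disjoint (index≤r i) (step e)) ,
      (λ i j i→j → reachable-⊆ (castʷ i→j ∘ step (E-sym e)) , reachable-⊆ (castʷ i→j ∘ step e))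

  colouring⇒helical : X ⟶ Helical (suc (suc m′)) 1 (suc r)
  colouring⇒helical = (λ v → vertex v (neighbour? v)) , λ {v} {u} e → edge e (neighbour? v) (neighbour? u)
    where
    neighbour? : ∀ v → Dec (Σ (V X) (E X v))
    neighbour? v = search (E X v) (E? v)

power-colouring⇒helical : ∀ G N r m′ → power (suc (2 * r)) (S (suc N) G) ⟶ K (suc (suc m′)) →
                          toGraph G ⟶ power (suc N) (Helical (suc (suc m′)) 1 (suc r))
power-colouring⇒helical G N r m′ c =
  subdivision⇒power G N (colouring⇒helical (S-sym G N) (S-edge? G N) (S-searchable G N) c)

helical⇒power-colouring : ∀ G N r m → toGraph G ⟶ power (suc N) (Helical m 1 (suc r)) →
                          power (suc (2 * r)) (S (suc N) G) ⟶ K m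
helical⇒power-colouring G N r m f =
  _∘ʰ_ {C = K m} (helical-power-colouring m r)
                 (power-map (suc (2 * r)) (power⇒subdivision (λ {P} {Q} → helical-sym m 1 (suc r) {P} {Q}) G N f))

corollary2p4 : (G : FinGraph) → ¬ Bipartite (toGraph G) → (m : ℕ) → 2 ≤ m → (r s : ℕ)
    → (g : ℕ) → IsOddGirth (toGraph G) g
    → suc (2 * s) ≤ suc (2 * r) → suc (2 * r) < g * suc (2 * s)
    → ((fracPow G r s ⟶ K m) → (toGraph G ⟶ power (suc (2 * s)) (Helical m 1 (suc r))))
    × ((toGraph G ⟶ power (suc (2 * s)) (Helical m 1 (suc r))) → (fracPow G r s ⟶ K m))
corollary2p4 _ _ (suc zero) (s≤s ()) _ _ _ _ _ _
corollary2p4 G _ (suc (suc m′)) _ r s _ _ _ _ =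
  power-colouring⇒helical G (2 * s) r m′ , helical⇒power-colouring G (2 * s) r (suc (suc m′))
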